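{- Let $\mathcal{C}$ be a monoidal dagger category and $T$ a strong Frobenius monad on $\mathcal{C}$. Let $B=T(I)$ with monoid structure $m=\mu_I\circ T(\rho_{T(I)})\circ\mathrm{st}_{T(I),I}$, $e=\eta_I$, and let $\kappa_A=T(\rho_A)\circ\mathrm{st}_{A,I}\colon A\otimes T(I)\to T(A)$. Then $\kappa$ is a morphism of comonads from the comonad $-\otimes B$ (comultiplication $\alpha_{A,B,B}\circ(\mathrm{id}_A\otimes m^\dagger)$, counit $\rho_A\circ(\mathrm{id}_A\otimes e^\dagger)$) to the comonad $(T,\mu^\dagger,\eta^\dagger)$.
   Context: A monoidal dagger category is a monoidal category with an identity-on-objects contravariant involutive functor $f\mapsto f^\dagger$ with $(f\otimes g)^\dagger=f^\dagger\otimes g^\dagger$ and unitary $\alpha,\lambda,\rho$. A Frobenius monad is a monad $(T,\mu,\eta)$ with $T(f^\dagger)=T(f)^\dagger$ and $T(\mu_A)\circ\mu^\dagger_{T(A)}=\mu_{T(A)}\circ T(\mu_A^\dagger)$; then $(T,\mu^\dagger,\eta^\dagger)$ is a comonad. A strong monad has a natural $\mathrm{st}_{A,B}\colon A\otimes T(B)\to T(A\otimes B)$ with $\mathrm{st}\circ\alpha=T(\alpha)\circ\mathrm{st}\circ(\mathrm{id}\otimes\mathrm{st})$, $T(\lambda)\circ\mathrm{st}=\lambda$, $\mathrm{st}\circ(\mathrm{id}\otimes\mu)=\mu\circ T(\mathrm{st})\circ\mathrm{st}$, $\mathrm{st}\circ(\mathrm{id}\otimes\eta)=\eta$; a strong Frobenius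 monad is a Frobenius monad that is strong with all $\mathrm{st}$ unitary. A morphism of comonads $\kappa\colon(F,\delta^F,\varepsilon^F)\to(G,\delta^G,\varepsilon^G)$ is a natural transformation with $\varepsilon^G\circ\kappa=\varepsilon^F$ and $\delta^G_A\circ\kappa_A=G(\kappa_A)\circ\kappa_{F(A)}\circ F(\kappa_A)\ldots$, i.e. $\delta^G\circ\kappa=(\kappa\ast\kappa)\circ\delta^F$ where $(\kappa\ast\kappa)_A=G(\kappa_A)\circ\kappa_{F(A)}$. -}

module Defs where

open import Level using (Level; _⊔_) renaming (suc to lsuc)
open import Data.Product using (_×_)
open import Relation.Binary.PropositionalEquality using (_≡_)

record Category (o ℓ : Level) : Set (lsuc (o ⊔ ℓ)) where
  infixr 9 _∘_
  field
    Obj : Set o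
    Hom : Obj → Obj → Set ℓ
    id  : ∀ {A} → Hom A A
    _∘_ : ∀ {A B C} → Hom B C → Hom A B → Hom A C
    identityˡ : ∀ {A B} {f : Hom A B} → id ∘ f ≡ f
    identityʳ : ∀ {A B} {f : Hom A B} → f ∘ id ≡ f
    assoc : ∀ {A B C D} {f : Hom A B} {g : Hom B C} {h : Hom C D} →
            (h ∘ g) ∘ f ≡ h ∘ (g ∘ f)

record Monoidal {o ℓ : Level} (C : Category o ℓ) : Set (o ⊔ ℓ) where
  open Category C
  infixr 10 _⊗₀_ _⊗₁_
  field
    _⊗₀_ : Obj → Obj → Obj
    _⊗₁_ : ∀ {A B C D} → Hom A B → Hom C D → Hom (A ⊗₀ C) (B ⊗₀ D)
    ⊗-identity : ∀ {A B} → id {A} ⊗₁ id {B} ≡ id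
    ⊗-homomorphism : ∀ {A B C D E F} {f : Hom B C} {g : Hom A B} {h : Hom E F} {k : Hom D E} →
                     (f ∘ g) ⊗₁ (h ∘ k) ≡ (f ⊗₁ h) ∘ (g ⊗₁ k)
    unit : Obj
    α   : ∀ {A B C} → Hom (A ⊗₀ (B ⊗₀ C)) ((A ⊗₀ B) ⊗₀ C)
    α⁻¹ : ∀ {A B C} → Hom ((A ⊗₀ B) ⊗₀ C) (A ⊗₀ (B ⊗₀ C))
    α-isoˡ : ∀ {A B C} → α⁻¹ ∘ α {A} {B} {C} ≡ id
    α-isoʳ : ∀ {A B C} → α ∘ α⁻¹ {A} {B} {C} ≡ id
    α-natural : ∀ {A A′ B B′ C C′} {f : Hom A A′} {g : Hom B B′} {h : Hom C C′} →
                α ∘ (f ⊗₁ (g ⊗₁ h)) ≡ ((f ⊗₁ g) ⊗₁ h) ∘ α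
    λᵤ   : ∀ {A} → Hom (unit ⊗₀ A) A
    λᵤ⁻¹ : ∀ {A} → Hom A (unit ⊗₀ A)
    λ-isoˡ : ∀ {A} → λᵤ⁻¹ ∘ λᵤ {A} ≡ id
    λ-isoʳ : ∀ {A} → λᵤ ∘ λᵤ⁻¹ {A} ≡ id
    λ-natural : ∀ {A B} {f : Hom A B} → λᵤ ∘ (id ⊗₁ f) ≡ f ∘ λᵤ
    ρᵤ   : ∀ {A} → Hom (A ⊗₀ unit) A
    ρᵤ⁻¹ : ∀ {A} → Hom A (A ⊗₀ unit)
    ρ-isoˡ : ∀ {A} → ρᵤ⁻¹ ∘ ρᵤ {A} ≡ id
    ρ-isoʳ : ∀ {A} → ρᵤ ∘ ρᵤ⁻¹ {A} ≡ id
    ρ-natural : ∀ {A B} {f : Hom A B} → ρᵤ ∘ (f ⊗₁ id) ≡ f ∘ ρᵤ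
    triangle : ∀ {A B} → (ρᵤ {A} ⊗₁ id {B}) ∘ α ≡ id ⊗₁ λᵤ
    pentagon : ∀ {A B C D} →
               α {A ⊗₀ B} {C} {D} ∘ α {A} {B} {C ⊗₀ D}
                 ≡ (α ⊗₁ id) ∘ (α {A} {B ⊗₀ C} {D} ∘ (id ⊗₁ α))

record MonoidalDaggerCategory (o ℓ : Level) : Set (lsuc (o ⊔ ℓ)) where
  field
    cat : Category o ℓ
    monoidal : Monoidal cat
  open Category cat public
  open Monoidal monoidal public
  infix 11 _†
  field
    _† : ∀ {A B} → Hom A B → Hom B A
    †-involutive : ∀ {A B} {f : Hom A B} → (f †) † ≡ f
    †-identity : ∀ {A} → id {A} † ≡ id
    †-homomorphism : ∀ {A B C} {f : Hom A B} {g : Hom B C} → (g ∘ f) † ≡ f † ∘ g †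
    †-⊗ : ∀ {A B C D} {f : Hom A B} {g : Hom C D} → (f ⊗₁ g) † ≡ (f †) ⊗₁ (g †)

  Unitary : ∀ {A B} → Hom A B → Set ℓ
  Unitary f = (f † ∘ f ≡ id) × (f ∘ f † ≡ id)

  field
    α-unitary : ∀ {A B C} → Unitary (α {A} {B} {C})
    λ-unitary : ∀ {A} → Unitary (λᵤ {A})
    ρ-unitary : ∀ {A} → Unitary (ρᵤ {A})

record StrongFrobeniusMonad {o ℓ : Level} (𝒞 : MonoidalDaggerCategory o ℓ) : Set (o ⊔ ℓ) where
  open MonoidalDaggerCategory 𝒞
  field
    T₀ : Obj → Obj
    T₁ : ∀ {A B} → Hom A B → Hom (T₀ A) (T₀ B)
    T-identity : ∀ {A} → T₁ (id {A}) ≡ id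
    T-homomorphism : ∀ {A B C} {f : Hom A B} {g : Hom B C} → T₁ (g ∘ f) ≡ T₁ g ∘ T₁ f
    η : ∀ A → Hom A (T₀ A)
    μ : ∀ A → Hom (T₀ (T₀ A)) (T₀ A)
    η-natural : ∀ {A B} {f : Hom A B} → η B ∘ f ≡ T₁ f ∘ η A
    μ-natural : ∀ {A B} {f : Hom A B} → μ B ∘ T₁ (T₁ f) ≡ T₁ f ∘ μ A
    μ-assoc : ∀ {A} → μ A ∘ T₁ (μ A) ≡ μ A ∘ μ (T₀ A)
    μ-identityˡ : ∀ {A} → μ A ∘ T₁ (η A) ≡ id
    μ-identityʳ : ∀ {A} → μ A ∘ η (T₀ A) ≡ id
    T-† : ∀ {A B} {f : Hom A B} → T₁ (f †) ≡ (T₁ f) †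
    frobenius : ∀ {A} → T₁ (μ A) ∘ (μ (T₀ A)) † ≡ μ (T₀ A) ∘ T₁ (μ A †)
    st : ∀ A B → Hom (A ⊗₀ T₀ B) (T₀ (A ⊗₀ B))
    st-natural : ∀ {A A′ B B′} {f : Hom A A′} {g : Hom B B′} →
                 st A′ B′ ∘ (f ⊗₁ T₁ g) ≡ T₁ (f ⊗₁ g) ∘ st A B
    st-α : ∀ {A B C} → st (A ⊗₀ B) C ∘ α ≡ T₁ α ∘ (st A (B ⊗₀ C) ∘ (id ⊗₁ st B C))
    st-λ : ∀ {A} → T₁ λᵤ ∘ st unit A ≡ λᵤ
    st-μ : ∀ {A B} → st A B ∘ (id ⊗₁ μ B) ≡ μ (A ⊗₀ B) ∘ (T₁ (st A B) ∘ st A (T₀ B))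
    st-η : ∀ {A B} → st A B ∘ (id ⊗₁ η B) ≡ η (A ⊗₀ B)
    st-unitary : ∀ {A B} → Unitary (st A B)

record IsComonadMorphism {o ℓ : Level} (C : Category o ℓ)
    (F₀ : Category.Obj C → Category.Obj C)
    (F₁ : ∀ {A B} → Category.Hom C A B → Category.Hom C (F₀ A) (F₀ B))
    (δᶠ : ∀ A → Category.Hom C (F₀ A) (F₀ (F₀ A)))
    (εᶠ : ∀ A → Category.Hom C (F₀ A) A)
    (G₀ : Category.Obj C → Category.Obj C)
    (G₁ : ∀ {A B} → Category.Hom C A B → Category.Hom C (G₀ A) (G₀ B))
    (δᵍ : ∀ A → Category.Hom C (G₀ A) (G₀ (G₀ A)))
    (εᵍ : ∀ A → Category.Hom C (G₀ A) A)
    (κ : ∀ A → Category.Hom C (F₀ A) (G₀ A)) : Set (o ⊔ ℓ) where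
  open Category C
  field
    natural : ∀ {A B} {f : Hom A B} → κ B ∘ F₁ f ≡ G₁ f ∘ κ A
    counit  : ∀ {A} → εᵍ A ∘ κ A ≡ εᶠ A
    comult  : ∀ {A} → δᵍ A ∘ κ A ≡ G₁ (κ A) ∘ (κ (F₀ A) ∘ δᶠ A)

module Construction {o ℓ : Level} (𝒞 : MonoidalDaggerCategory o ℓ)
                    (𝕋 : StrongFrobeniusMonad 𝒞) where
  open MonoidalDaggerCategory 𝒞
  open StrongFrobeniusMonad 𝕋

  B : Obj
  B = T₀ unit

  m : Hom (B ⊗₀ B) B
  m = μ unit ∘ (T₁ (ρᵤ {T₀ unit}) ∘ st (T₀ unit) unit)

  e : Hom unit B
  e = η unit

  κ : ∀ A → Hom (A ⊗₀ B) (T₀ A)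
  κ A = T₁ (ρᵤ {A}) ∘ st A unit

  F₀ : Obj → Obj
  F₀ A = A ⊗₀ B

  F₁ : ∀ {A A′} → Hom A A′ → Hom (F₀ A) (F₀ A′)
  F₁ f = f ⊗₁ id

  δ⊗ : ∀ A → Hom (F₀ A) (F₀ (F₀ A))
  δ⊗ A = α {A} {B} {B} ∘ (id ⊗₁ m †)

  ε⊗ : ∀ A → Hom (F₀ A) A
  ε⊗ A = ρᵤ {A} ∘ (id ⊗₁ e †)

  δT : ∀ A → Hom (T₀ A) (T₀ (T₀ A))
  δT A = μ A †

  εT : ∀ A → Hom (T₀ A) A
  εT A = η A †

-- κ is unitary, so each comonad law for κ is the dagger of the corresponding monoid-action
-- law: κ ∘ (id ⊗ η) = η ∘ ρ and κ ∘ (id ⊗ m) = μ ∘ T κ ∘ κ ∘ α.  Transposing these squares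
-- across the unitaries κ, ρ and T κ ∘ κ ∘ α turns η, m into η†, m† and μ into μ†.  The
-- multiplicative square follows from the strength axioms for μ and α together with Kelly's
-- coherence ρ ∘ α = id ⊗ ρ.
module Submission where

open import Defs
open import Level using (Level)
open import Data.Product using (_,_; proj₁; proj₂)
open import Relation.Binary.PropositionalEquality

module CategoryProperties {o ℓ : Level} (C : Category o ℓ) where
  open Category C

  pullˡ : ∀ {W X Y Z} {a : Hom Y Z} {b : Hom X Y} {c : Hom X Z} {f : Hom W X} →
          a ∘ b ≡ c → a ∘ b ∘ f ≡ c ∘ f
  pullˡ {f = f} p = trans (sym assoc) (cong (_∘ f) p)

  extendˡ : ∀ {W X Y Z V} {a : Hom Y Z} {b : Hom X Y} {c : Hom V Z} {d : Hom X V} {f : Hom W X} →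
            a ∘ b ≡ c ∘ d → a ∘ b ∘ f ≡ c ∘ d ∘ f
  extendˡ p = trans (pullˡ p) assoc

  cancelInner : ∀ {W X Y Z} {a : Hom Y Z} {b : Hom X Y} {c : Hom Y X} {f : Hom W Y} →
                b ∘ c ≡ id → a ∘ b ∘ c ∘ f ≡ a ∘ f
  cancelInner {a = a} p = cong (a ∘_) (trans (pullˡ p) identityˡ)

  split-epi-cancelʳ : ∀ {X Y Z} {f g : Hom Y Z} {h : Hom X Y} {h′ : Hom Y X} →
                      h ∘ h′ ≡ id → f ∘ h ≡ g ∘ h → f ≡ g
  split-epi-cancelʳ {f = f} {g} {h} {h′} inv p = begin
    f             ≡⟨ sym identityʳ ⟩
    f ∘ id        ≡⟨ cong (f ∘_) (sym inv) ⟩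
    f ∘ h ∘ h′    ≡⟨ pullˡ p ⟩
    (g ∘ h) ∘ h′  ≡⟨ assoc ⟩
    g ∘ h ∘ h′    ≡⟨ cong (g ∘_) inv ⟩
    g ∘ id        ≡⟨ identityʳ ⟩
    g             ∎
    where open ≡-Reasoning

module MonoidalProperties {o ℓ : Level} (C : Category o ℓ) (M : Monoidal C) where
  open Category C
  open Monoidal M
  open CategoryProperties C
  open ≡-Reasoning

  id⊗-∘ : ∀ {A X Y Z} {f : Hom Y Z} {g : Hom X Y} → id {A} ⊗₁ (f ∘ g) ≡ (id ⊗₁ f) ∘ (id ⊗₁ g)
  id⊗-∘ {f = f} {g} = trans (cong (_⊗₁ (f ∘ g)) (sym identityˡ)) ⊗-homomorphism

  ∘-⊗id : ∀ {A X Y Z} {f : Hom Y Z} {g : Hom X Y} → (f ∘ g) ⊗₁ id {A} ≡ (f ⊗₁ id) ∘ (g ⊗₁ id)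
  ∘-⊗id {f = f} {g} = trans (cong ((f ∘ g) ⊗₁_) (sym identityˡ)) ⊗-homomorphism

  -⊗unit-faithful : ∀ {X Y} {f g : Hom X Y} → f ⊗₁ id {unit} ≡ g ⊗₁ id → f ≡ g
  -⊗unit-faithful {f = f} {g} p = split-epi-cancelʳ ρ-isoʳ (begin
    f ∘ ρᵤ             ≡⟨ sym ρ-natural ⟩
    ρᵤ ∘ (f ⊗₁ id)     ≡⟨ cong (ρᵤ ∘_) p ⟩
    ρᵤ ∘ (g ⊗₁ id)     ≡⟨ ρ-natural ⟩
    g ∘ ρᵤ             ∎)

  -- Kelly's coherence: after tensoring with I, both sides agree once precomposed with the
  -- isomorphism α ∘ (id ⊗ α), by the pentagon and the triangle applied twice.
  ρ-α : ∀ {X Y} → ρᵤ {X ⊗₀ Y} ∘ α {X} {Y} {unit} ≡ id ⊗₁ ρᵤ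
  ρ-α = -⊗unit-faithful (split-epi-cancelʳ α∘id⊗α-inverse (begin
    ((ρᵤ ∘ α) ⊗₁ id) ∘ α ∘ (id ⊗₁ α)          ≡⟨ cong (_∘ α ∘ (id ⊗₁ α)) ∘-⊗id ⟩
    ((ρᵤ ⊗₁ id) ∘ (α ⊗₁ id)) ∘ α ∘ (id ⊗₁ α)  ≡⟨ assoc ⟩
    (ρᵤ ⊗₁ id) ∘ (α ⊗₁ id) ∘ α ∘ (id ⊗₁ α)    ≡⟨ cong ((ρᵤ ⊗₁ id) ∘_) (sym pentagon) ⟩
    (ρᵤ ⊗₁ id) ∘ α ∘ α                        ≡⟨ pullˡ triangle ⟩
    (id ⊗₁ λᵤ) ∘ α                            ≡⟨ cong (λ h → (h ⊗₁ λᵤ) ∘ α) (sym ⊗-identity) ⟩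
    ((id ⊗₁ id) ⊗₁ λᵤ) ∘ α                    ≡⟨ sym α-natural ⟩
    α ∘ (id ⊗₁ (id ⊗₁ λᵤ))                    ≡⟨ cong (λ h → α ∘ (id ⊗₁ h)) (sym triangle) ⟩
    α ∘ (id ⊗₁ ((ρᵤ ⊗₁ id) ∘ α))              ≡⟨ cong (α ∘_) id⊗-∘ ⟩
    α ∘ (id ⊗₁ (ρᵤ ⊗₁ id)) ∘ (id ⊗₁ α)        ≡⟨ extendˡ α-natural ⟩
    ((id ⊗₁ ρᵤ) ⊗₁ id) ∘ α ∘ (id ⊗₁ α)        ∎))
    where
    α∘id⊗α-inverse : ∀ {A B C D} →
      (α {A} {B ⊗₀ C} {D} ∘ (id ⊗₁ α)) ∘ (id ⊗₁ α⁻¹) ∘ α⁻¹ ≡ id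
    α∘id⊗α-inverse = begin
      (α ∘ (id ⊗₁ α)) ∘ (id ⊗₁ α⁻¹) ∘ α⁻¹  ≡⟨ assoc ⟩
      α ∘ (id ⊗₁ α) ∘ (id ⊗₁ α⁻¹) ∘ α⁻¹    ≡⟨ cancelInner (trans (sym id⊗-∘)
                                                (trans (cong (id ⊗₁_) α-isoʳ) ⊗-identity)) ⟩
      α ∘ α⁻¹                              ≡⟨ α-isoʳ ⟩
      id                                   ∎

module DaggerProperties {o ℓ : Level} (𝒞 : MonoidalDaggerCategory o ℓ) where
  open MonoidalDaggerCategory 𝒞
  open CategoryProperties cat
  open ≡-Reasoning

  id⊗-† : ∀ {A X Y} {f : Hom X Y} → (id {A} ⊗₁ f) † ≡ id ⊗₁ f †
  id⊗-† {f = f} = trans †-⊗ (cong (_⊗₁ f †) †-identity)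

  unitary-∘ : ∀ {X Y Z} {f : Hom X Y} {g : Hom Y Z} → Unitary f → Unitary g → Unitary (g ∘ f)
  unitary-∘ {f = f} {g} (f†f , ff†) (g†g , gg†) =
    (begin
      (g ∘ f) † ∘ g ∘ f    ≡⟨ cong (_∘ g ∘ f) †-homomorphism ⟩
      (f † ∘ g †) ∘ g ∘ f  ≡⟨ assoc ⟩
      f † ∘ g † ∘ g ∘ f    ≡⟨ cancelInner g†g ⟩
      f † ∘ f              ≡⟨ f†f ⟩
      id                   ∎) ,
    (begin
      (g ∘ f) ∘ (g ∘ f) †  ≡⟨ cong ((g ∘ f) ∘_) †-homomorphism ⟩
      (g ∘ f) ∘ f † ∘ g †  ≡⟨ assoc ⟩
      g ∘ f ∘ f † ∘ g †    ≡⟨ cancelInner ff† ⟩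
      g ∘ g †              ≡⟨ gg† ⟩
      id                   ∎)

  transpose-square : ∀ {A B C D} {f : Hom A B} {v : Hom B C} {g : Hom D C} {u : Hom A D} →
                     u ∘ u † ≡ id → v † ∘ v ≡ id → v ∘ f ≡ g ∘ u → u ∘ f † ≡ g † ∘ v
  transpose-square {f = f} {v} {g} {u} uu† v†v square = begin
    u ∘ f †                ≡⟨ cong (u ∘_) (sym identityʳ) ⟩
    u ∘ f † ∘ id           ≡⟨ cong (λ h → u ∘ f † ∘ h) (sym v†v) ⟩
    u ∘ f † ∘ v † ∘ v      ≡⟨ cong (u ∘_) (extendˡ square†) ⟩
    u ∘ u † ∘ g † ∘ v      ≡⟨ pullˡ uu† ⟩
    id ∘ g † ∘ v           ≡⟨ identityˡ ⟩
    g † ∘ v                ∎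
    where
    square† : f † ∘ v † ≡ u † ∘ g †
    square† = trans (sym †-homomorphism) (trans (cong _† square) †-homomorphism)

module StrongFrobeniusProperties {o ℓ : Level} (𝒞 : MonoidalDaggerCategory o ℓ)
                                 (𝕋 : StrongFrobeniusMonad 𝒞) where
  open MonoidalDaggerCategory 𝒞
  open StrongFrobeniusMonad 𝕋
  open Construction 𝒞 𝕋
  open CategoryProperties cat
  open MonoidalProperties cat monoidal
  open DaggerProperties 𝒞
  open ≡-Reasoning

  T-unitary : ∀ {X Y} {f : Hom X Y} → Unitary f → Unitary (T₁ f)
  T-unitary {f = f} (f†f , ff†) =
    trans (cong (_∘ T₁ f) (sym T-†)) (trans (sym T-homomorphism) (trans (cong T₁ f†f) T-identity)) ,
    trans (cong (T₁ f ∘_) (sym T-†)) (trans (sym T-homomorphism) (trans (cong T₁ ff†) T-identity))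

  κ-unitary : ∀ {X} → Unitary (κ X)
  κ-unitary = unitary-∘ st-unitary (T-unitary ρ-unitary)

  st-α† : ∀ {X Y Z} → st X (Y ⊗₀ Z) ∘ (id ⊗₁ st Y Z) ≡ T₁ (α †) ∘ st (X ⊗₀ Y) Z ∘ α
  st-α† = sym (begin
    T₁ (α †) ∘ st _ _ ∘ α                       ≡⟨ cong (T₁ (α †) ∘_) st-α ⟩
    T₁ (α †) ∘ T₁ α ∘ st _ _ ∘ (id ⊗₁ st _ _)   ≡⟨ pullˡ (sym T-homomorphism) ⟩
    T₁ (α † ∘ α) ∘ st _ _ ∘ (id ⊗₁ st _ _)      ≡⟨ cong (λ h → T₁ h ∘ st _ _ ∘ (id ⊗₁ st _ _))
                                                     (proj₁ α-unitary) ⟩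
    T₁ id ∘ st _ _ ∘ (id ⊗₁ st _ _)             ≡⟨ cong (_∘ st _ _ ∘ (id ⊗₁ st _ _)) T-identity ⟩
    id ∘ st _ _ ∘ (id ⊗₁ st _ _)                ≡⟨ identityˡ ⟩
    st _ _ ∘ (id ⊗₁ st _ _)                     ∎)

  κ-natural : ∀ {X Y} {f : Hom X Y} → κ Y ∘ F₁ f ≡ T₁ f ∘ κ X
  κ-natural {X} {Y} {f} = begin
    (T₁ ρᵤ ∘ st Y unit) ∘ (f ⊗₁ id)    ≡⟨ assoc ⟩
    T₁ ρᵤ ∘ st Y unit ∘ (f ⊗₁ id)      ≡⟨ cong (λ h → T₁ ρᵤ ∘ st Y unit ∘ (f ⊗₁ h)) (sym T-identity) ⟩
    T₁ ρᵤ ∘ st Y unit ∘ (f ⊗₁ T₁ id)   ≡⟨ cong (T₁ ρᵤ ∘_) st-natural ⟩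
    T₁ ρᵤ ∘ T₁ (f ⊗₁ id) ∘ st X unit   ≡⟨ pullˡ (sym T-homomorphism) ⟩
    T₁ (ρᵤ ∘ (f ⊗₁ id)) ∘ st X unit    ≡⟨ cong (λ h → T₁ h ∘ st X unit) ρ-natural ⟩
    T₁ (f ∘ ρᵤ) ∘ st X unit            ≡⟨ cong (_∘ st X unit) T-homomorphism ⟩
    (T₁ f ∘ T₁ ρᵤ) ∘ st X unit         ≡⟨ assoc ⟩
    T₁ f ∘ T₁ ρᵤ ∘ st X unit           ∎

  κ-η : ∀ {X} → κ X ∘ (id ⊗₁ e) ≡ η X ∘ ρᵤ
  κ-η {X} = begin
    (T₁ ρᵤ ∘ st X unit) ∘ (id ⊗₁ η unit)  ≡⟨ assoc ⟩
    T₁ ρᵤ ∘ st X unit ∘ (id ⊗₁ η unit)    ≡⟨ cong (T₁ ρᵤ ∘_) st-η ⟩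
    T₁ ρᵤ ∘ η (X ⊗₀ unit)                 ≡⟨ sym η-natural ⟩
    η X ∘ ρᵤ                              ∎

  κ-μ : ∀ {X} → κ X ∘ (id ⊗₁ μ unit) ≡ μ X ∘ T₁ (κ X) ∘ st X B
  κ-μ {X} = begin
    (T₁ ρᵤ ∘ st X unit) ∘ (id ⊗₁ μ unit)            ≡⟨ assoc ⟩
    T₁ ρᵤ ∘ st X unit ∘ (id ⊗₁ μ unit)              ≡⟨ cong (T₁ ρᵤ ∘_) st-μ ⟩
    T₁ ρᵤ ∘ μ (X ⊗₀ unit) ∘ T₁ (st X unit) ∘ st X B  ≡⟨ extendˡ (sym μ-natural) ⟩
    μ X ∘ T₁ (T₁ ρᵤ) ∘ T₁ (st X unit) ∘ st X B       ≡⟨ cong (μ X ∘_) (pullˡ (sym T-homomorphism)) ⟩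
    μ X ∘ T₁ (κ X) ∘ st X B                         ∎

  st-κ : ∀ {X Y} → st X Y ∘ (id ⊗₁ κ Y) ≡ κ (X ⊗₀ Y) ∘ α
  st-κ {X} {Y} = begin
    st X Y ∘ (id ⊗₁ (T₁ ρᵤ ∘ st Y unit))              ≡⟨ cong (st X Y ∘_) id⊗-∘ ⟩
    st X Y ∘ (id ⊗₁ T₁ ρᵤ) ∘ (id ⊗₁ st Y unit)        ≡⟨ extendˡ st-natural ⟩
    T₁ (id ⊗₁ ρᵤ) ∘ st X (Y ⊗₀ unit) ∘ (id ⊗₁ st Y unit) ≡⟨ cong (T₁ (id ⊗₁ ρᵤ) ∘_) st-α† ⟩
    T₁ (id ⊗₁ ρᵤ) ∘ T₁ (α †) ∘ st (X ⊗₀ Y) unit ∘ α   ≡⟨ pullˡ (trans (sym T-homomorphism)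
                                                          (cong T₁ id⊗ρ∘α†)) ⟩
    T₁ ρᵤ ∘ st (X ⊗₀ Y) unit ∘ α                      ≡⟨ sym assoc ⟩
    κ (X ⊗₀ Y) ∘ α                                    ∎
    where
    id⊗ρ∘α† : (id ⊗₁ ρᵤ) ∘ α † ≡ ρᵤ
    id⊗ρ∘α† = begin
      (id ⊗₁ ρᵤ) ∘ α †  ≡⟨ cong (_∘ α †) (sym ρ-α) ⟩
      (ρᵤ ∘ α) ∘ α †    ≡⟨ assoc ⟩
      ρᵤ ∘ α ∘ α †      ≡⟨ cong (ρᵤ ∘_) (proj₂ α-unitary) ⟩
      ρᵤ ∘ id           ≡⟨ identityʳ ⟩
      ρᵤ                ∎

  κ-m : ∀ {X} → κ X ∘ (id ⊗₁ m) ≡ μ X ∘ T₁ (κ X) ∘ κ (F₀ X) ∘ α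
  κ-m {X} = begin
    κ X ∘ (id ⊗₁ (μ unit ∘ κ B))               ≡⟨ cong (κ X ∘_) id⊗-∘ ⟩
    κ X ∘ (id ⊗₁ μ unit) ∘ (id ⊗₁ κ B)         ≡⟨ extendˡ κ-μ ⟩
    μ X ∘ (T₁ (κ X) ∘ st X B) ∘ (id ⊗₁ κ B)    ≡⟨ cong (μ X ∘_) (trans assoc (cong (T₁ (κ X) ∘_) st-κ)) ⟩
    μ X ∘ T₁ (κ X) ∘ κ (F₀ X) ∘ α              ∎

  κ-counit : ∀ {X} → εT X ∘ κ X ≡ ε⊗ X
  κ-counit = sym (trans (cong (ρᵤ ∘_) (sym id⊗-†))
               (transpose-square (proj₂ ρ-unitary) (proj₁ κ-unitary) κ-η))

  κ-comult : ∀ {X} → δT X ∘ κ X ≡ T₁ (κ X) ∘ (κ (F₀ X) ∘ δ⊗ X)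
  κ-comult {X} = sym (begin
    T₁ (κ X) ∘ κ (F₀ X) ∘ α ∘ (id ⊗₁ m †)      ≡⟨ cong (λ h → T₁ (κ X) ∘ κ (F₀ X) ∘ α ∘ h) (sym id⊗-†) ⟩
    T₁ (κ X) ∘ κ (F₀ X) ∘ α ∘ (id ⊗₁ m) †      ≡⟨ trans (cong (T₁ (κ X) ∘_) (sym assoc)) (sym assoc) ⟩
    (T₁ (κ X) ∘ κ (F₀ X) ∘ α) ∘ (id ⊗₁ m) †    ≡⟨ transpose-square (proj₂ U-unitary) (proj₁ κ-unitary) κ-m ⟩
    μ X † ∘ κ X                                ∎)
    where
    U-unitary : Unitary (T₁ (κ X) ∘ κ (F₀ X) ∘ α)
    U-unitary = unitary-∘ (unitary-∘ α-unitary κ-unitary) (T-unitary κ-unitary)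

lemmaA3 : ∀ {o ℓ : Level} (𝒞 : MonoidalDaggerCategory o ℓ) (𝕋 : StrongFrobeniusMonad 𝒞) →
    IsComonadMorphism (MonoidalDaggerCategory.cat 𝒞)
      (Construction.F₀ 𝒞 𝕋) (Construction.F₁ 𝒞 𝕋) (Construction.δ⊗ 𝒞 𝕋) (Construction.ε⊗ 𝒞 𝕋)
      (StrongFrobeniusMonad.T₀ 𝕋) (StrongFrobeniusMonad.T₁ 𝕋) (Construction.δT 𝒞 𝕋) (Construction.εT 𝒞 𝕋)
      (Construction.κ 𝒞 𝕋)
lemmaA3 𝒞 𝕋 = record { natural = κ-natural ; counit = κ-counit ; comult = κ-comult }
  where open StrongFrobeniusProperties 𝒞 𝕋
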